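{- For every integer $d \geq 4$, the complete bipartite graph $K_{4,d}$ satisfies $\chi'_{st}(K_{4,d}) \geq \frac{10d}{6}$.
   Context: A star edge coloring of a graph is a proper edge coloring in which there is no path or cycle of length four (i.e., with four edges) whose edges use only two colors. The star chromatic index $\chi'_{st}(G)$ is the minimum number $t$ such that $G$ has a star edge coloring with $t$ colors. -}

module Defs where

open import Data.Nat using (ℕ; _≤_; _<_; _*_)
open import Data.Fin using (Fin; toℕ)
open import Data.Product using (_×_; Σ; ∃; ∃-syntax; _,_)
open import Data.Sum using (_⊎_; inj₁; inj₂)
open import Data.Empty using (⊥)
open import Relation.Nullary using (¬_)
open import Relation.Binary.PropositionalEquality using (_≡_; _≢_)
open import Level using (0ℓ; suc)

record Graph : Set₁ where
  field
    vertices : ℕ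
    Adj      : Fin vertices → Fin vertices → Set
    adj-sym  : ∀ {u v} → Adj u v → Adj v u
    irrefl   : ∀ {u} → ¬ Adj u u

open Graph public

Kbip : ℕ → ℕ → Graph
Kbip m n = record
  { vertices = m Data.Nat.+ n
  ; Adj      = λ u v → (toℕ u < m × m ≤ toℕ v) ⊎ (m ≤ toℕ u × toℕ v < m)
  ; adj-sym  = λ { (inj₁ (a , b)) → inj₂ (b , a) ; (inj₂ (a , b)) → inj₁ (b , a) }
  ; irrefl   = irr
  }
  where
  open import Data.Nat.Properties using (<⇒≱)
  irr : ∀ {u} → ¬ ((toℕ u < m × m ≤ toℕ u) ⊎ (m ≤ toℕ u × toℕ u < m))
  irr (inj₁ (a , b)) = <⇒≱ a b
  irr (inj₂ (a , b)) = <⇒≱ b a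

record EdgeColoring (G : Graph) (t : ℕ) : Set where
  field
    col     : (u v : Fin (vertices G)) → Adj G u v → Fin t
    col-irr : ∀ {u v} (p q : Adj G u v) → col u v p ≡ col u v q
    col-sym : ∀ {u v} (p : Adj G u v) → col u v p ≡ col v u (adj-sym G p)

open EdgeColoring public

Proper : ∀ {G t} → EdgeColoring G t → Set
Proper {G} c = ∀ {u v w} (p : Adj G u v) (q : Adj G u w) →
  v ≢ w → col c u v p ≢ col c u w q

-- A walk v0 v1 v2 v3 v4 with four edges that is a path (all five vertices
-- distinct) or a cycle of length four (v0 ≡ v4, the other vertices distinct).
record PathOrCycle4 (G : Graph) : Set where
  field
    v0 v1 v2 v3 v4 : Fin (vertices G)
    e1 : Adj G v0 v1
    e2 : Adj G v1 v2
    e3 : Adj G v2 v3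
    e4 : Adj G v3 v4
    d01 : v0 ≢ v1
    d02 : v0 ≢ v2
    d03 : v0 ≢ v3
    d12 : v1 ≢ v2
    d13 : v1 ≢ v3
    d14 : v1 ≢ v4
    d23 : v2 ≢ v3
    d24 : v2 ≢ v4
    d34 : v3 ≢ v4

Bicolored : ∀ {G t} → EdgeColoring G t → PathOrCycle4 G → Set
Bicolored {G} {t} c P =
  ∃[ a ] ∃[ b ] (In (col c v0 v1 e1) a b × In (col c v1 v2 e2) a b ×
                 In (col c v2 v3 e3) a b × In (col c v3 v4 e4) a b)
  where
  open PathOrCycle4 P
  In : Fin t → Fin t → Fin t → Set
  In x a b = x ≡ a ⊎ x ≡ b

record StarEdgeColoring (G : Graph) (t : ℕ) : Set where
  field
    coloring : EdgeColoring G t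
    proper   : Proper coloring
    star     : (P : PathOrCycle4 G) → ¬ Bicolored coloring P

-- χ'_st(G) ≥ x  (for x = p/q with q > 0) unfolds to: every star edge
-- coloring of G with t colors has t ≥ p/q, i.e. p ≤ q * t.
StarIndexAtLeast : Graph → (p q : ℕ) → Set
StarIndexAtLeast G p q = ∀ t → StarEdgeColoring G t → p ≤ q * t

module Submission where

-- Let φ i y be the colour of the edge joining the i-th vertex of the 4-side to the y-th
-- vertex of the d-side, and k c the number of vertices of the 4-side at which colour c
-- appears, so that ∑ k c = 4d. Counting ∑ k c² as the number of triples (i, j, y) such
-- that φ i y appears at j: for i ≢ j and a fixed y, φ i y cannot appear at j while φ j y
-- appears at i, as that gives a bicoloured path x i y j w. Hence ∑ k c² ≤ 4d + 6d.
-- Since 5k ≤ 6 + k² on the integers, 20d = 5 ∑ k c ≤ 6t + ∑ k c² ≤ 6t + 10d.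

open import Defs
open import Data.Nat using (ℕ; zero; suc; _+_; _*_; _≤_; _<_; z≤n; s≤s)
open import Data.Nat.Properties
open import Data.Nat.Tactic.RingSolver using (solve; solve-∀)
open import Data.List.Base using (_∷_; [])
open import Data.Fin using (Fin; zero; suc; toℕ; _↑ˡ_; _↑ʳ_)
import Data.Fin.Properties as Finₚ
open import Data.Bool using (if_then_else_)
open import Data.Product using (∃-syntax; _,_)
open import Data.Sum using (inj₁; inj₂)
open import Data.Empty using (⊥)
open import Function using (_∘_)
open import Function.Definitions using (Injective)
open import Relation.Nullary using (does; yes; no; contradiction)
open import Relation.Binary.PropositionalEquality
open import Algebra.Properties.Semiring.Sum +-*-semiring
  using (sum-syntax; ∑-comm; ∑-distrib-+; *-distribˡ-sum; *-distribʳ-sum; sum-cong-≗; sum-replicate-zero)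

∑-mono-≤ : ∀ {n} {f g : Fin n → ℕ} → (∀ i → f i ≤ g i) → ∑[ i < n ] f i ≤ ∑[ i < n ] g i
∑-mono-≤ {zero}  _   = z≤n
∑-mono-≤ {suc n} f≤g = +-mono-≤ (f≤g zero) (∑-mono-≤ (f≤g ∘ suc))

∑-const : ∀ n x → ∑[ i < n ] x ≡ n * x
∑-const zero    x = refl
∑-const (suc n) x = cong (x +_) (∑-const n x)

∑-≤1 : ∀ {n} {f : Fin n → ℕ} → (∀ i → f i ≤ 1) → ∑[ i < n ] f i ≤ n
∑-≤1 {n} f≤1 = ≤-trans (∑-mono-≤ f≤1) (≤-reflexive (trans (∑-const n 1) (*-identityʳ n)))

∑-square : ∀ {m t} (f : Fin m → Fin t → ℕ) →
  ∑[ c < t ] ((∑[ i < m ] f i c) * (∑[ j < m ] f j c)) ≡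
  ∑[ i < m ] ∑[ j < m ] ∑[ c < t ] (f i c * f j c)
∑-square {m} {t} f = begin
  ∑[ c < t ] ((∑[ i < m ] f i c) * (∑[ j < m ] f j c))
    ≡⟨ sum-cong-≗ (λ c → *-distribʳ-sum (∑[ j < m ] f j c) (λ i → f i c)) ⟩
  ∑[ c < t ] ∑[ i < m ] (f i c * ∑[ j < m ] f j c)
    ≡⟨ sum-cong-≗ (λ c → sum-cong-≗ (λ i → *-distribˡ-sum (f i c) (λ j → f j c))) ⟩
  ∑[ c < t ] ∑[ i < m ] ∑[ j < m ] (f i c * f j c)
    ≡⟨ ∑-comm (λ c i → ∑[ j < m ] (f i c * f j c)) ⟩
  ∑[ i < m ] ∑[ c < t ] ∑[ j < m ] (f i c * f j c)
    ≡⟨ sum-cong-≗ (λ i → ∑-comm (λ c j → f i c * f j c)) ⟩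
  ∑[ i < m ] ∑[ j < m ] ∑[ c < t ] (f i c * f j c) ∎
  where open ≡-Reasoning

δ : ∀ {t} → Fin t → Fin t → ℕ
δ a c = if does (a Finₚ.≟ c) then 1 else 0

δ-≢ : ∀ {t} {a c : Fin t} → a ≢ c → δ a c ≡ 0
δ-≢ {a = a} {c} a≢c with a Finₚ.≟ c
... | yes a≡c = contradiction a≡c a≢c
... | no  _   = refl

∑-δ-* : ∀ {t} (a : Fin t) (f : Fin t → ℕ) → ∑[ c < t ] (δ a c * f c) ≡ f a
∑-δ-* {suc t} zero    f = trans (cong (f zero + 0 +_) (sum-replicate-zero t))
                                (trans (+-identityʳ _) (+-identityʳ _))
∑-δ-* {suc t} (suc a) f = ∑-δ-* a (f ∘ suc)

∑∑-symmetric-bound : ∀ {m} n (a : Fin m → Fin m → ℕ) →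
  (∀ i → a i i ≤ n) → (∀ {i j} → i ≢ j → a i j + a j i ≤ n) →
  2 * ∑[ i < m ] ∑[ j < m ] a i j ≤ m * (m + 1) * n
∑∑-symmetric-bound {m} n a diagonal off-diagonal = begin
  2 * S                                                ≡⟨ cong (S +_) (+-identityʳ S) ⟩
  S + S                                                ≡⟨ cong (S +_) (∑-comm a) ⟩
  S + ∑[ i < m ] ∑[ j < m ] a j i                      ≡⟨ ∑-distrib-+ (λ i → ∑[ j < m ] a i j) (λ i → ∑[ j < m ] a j i) ⟨
  ∑[ i < m ] (∑[ j < m ] a i j + ∑[ j < m ] a j i)     ≡⟨ sum-cong-≗ (λ i → ∑-distrib-+ (a i) (λ j → a j i)) ⟨
  ∑[ i < m ] ∑[ j < m ] (a i j + a j i)                ≤⟨ ∑-mono-≤ (∑-mono-≤ ∘ pair-bound) ⟩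
  ∑[ i < m ] ∑[ j < m ] (n + δ i j * n)                ≡⟨ sum-cong-≗ row-sum ⟩
  ∑[ i < m ] (m * n + n)                               ≡⟨ ∑-const m (m * n + n) ⟩
  m * (m * n + n)                                      ≡⟨ solve (m ∷ n ∷ []) ⟩
  m * (m + 1) * n                                      ∎
  where
  open ≤-Reasoning
  S = ∑[ i < m ] ∑[ j < m ] a i j

  pair-bound : ∀ i j → a i j + a j i ≤ n + δ i j * n
  pair-bound i j with i Finₚ.≟ j
  ... | yes refl = +-mono-≤ (diagonal i) (≤-trans (diagonal i) (≤-reflexive (sym (*-identityˡ n))))
  ... | no  i≢j  = ≤-trans (off-diagonal i≢j) (m≤m+n n 0)

  row-sum : ∀ i → ∑[ j < m ] (n + δ i j * n) ≡ m * n + n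
  row-sum i = trans (∑-distrib-+ (λ _ → n) (λ j → δ i j * n)) (cong₂ _+_ (∑-const m n) (∑-δ-* i (λ _ → n)))

5k≤6+k² : ∀ k → 5 * k ≤ 6 + k * k
5k≤6+k² 0 = z≤n
5k≤6+k² 1 = m≤m+n 5 2
5k≤6+k² 2 = ≤-refl
5k≤6+k² (suc (suc (suc k))) = ≤-trans (m≤m+n _ ((k + 1) * k)) (≤-reflexive (solve (k ∷ [])))

+-≤1 : ∀ {a b} → a ≤ 1 → b ≤ 1 → (0 < a → 0 < b → ⊥) → a + b ≤ 1
+-≤1 z≤n       b≤1       _         = b≤1
+-≤1 (s≤s z≤n) z≤n       _         = s≤s z≤n
+-≤1 (s≤s z≤n) (s≤s z≤n) not-both = contradiction (s≤s z≤n) (not-both (s≤s z≤n))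

fibre : ∀ {n t} → (Fin n → Fin t) → Fin t → ℕ
fibre {n} φ c = ∑[ y < n ] δ (φ y) c

∑-fibre-* : ∀ {n t} (φ : Fin n → Fin t) (f : Fin t → ℕ) →
  ∑[ c < t ] (fibre φ c * f c) ≡ ∑[ y < n ] f (φ y)
∑-fibre-* {n} {t} φ f = begin
  ∑[ c < t ] (fibre φ c * f c)             ≡⟨ sum-cong-≗ (λ c → *-distribʳ-sum (f c) (λ y → δ (φ y) c)) ⟩
  ∑[ c < t ] ∑[ y < n ] (δ (φ y) c * f c)  ≡⟨ ∑-comm (λ c y → δ (φ y) c * f c) ⟩
  ∑[ y < n ] ∑[ c < t ] (δ (φ y) c * f c)  ≡⟨ sum-cong-≗ (λ y → ∑-δ-* (φ y) f) ⟩
  ∑[ y < n ] f (φ y)                       ∎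
  where open ≡-Reasoning

∑-fibre : ∀ {n t} (φ : Fin n → Fin t) → ∑[ c < t ] fibre φ c ≡ n
∑-fibre {n} {t} φ = begin
  ∑[ c < t ] fibre φ c          ≡⟨ sum-cong-≗ (λ c → *-identityʳ (fibre φ c)) ⟨
  ∑[ c < t ] (fibre φ c * 1)    ≡⟨ ∑-fibre-* φ (λ _ → 1) ⟩
  ∑[ y < n ] 1                  ≡⟨ trans (∑-const n 1) (*-identityʳ n) ⟩
  n                             ∎
  where open ≡-Reasoning

fibre-∉ : ∀ {n t} (φ : Fin n → Fin t) {c} → (∀ y → φ y ≢ c) → fibre φ c ≡ 0
fibre-∉ {n} φ c∉φ = trans (sum-cong-≗ (λ y → δ-≢ (c∉φ y))) (sum-replicate-zero n)

fibre-≤1 : ∀ {n t} (φ : Fin n → Fin t) → Injective _≡_ _≡_ φ → ∀ c → fibre φ c ≤ 1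
fibre-≤1 {zero}  φ _     c = z≤n
fibre-≤1 {suc n} φ φ-inj c with φ zero Finₚ.≟ c
... | yes refl = ≤-reflexive (cong suc (fibre-∉ (φ ∘ suc) (λ y φy≡φ0 → Finₚ.0≢1+n (φ-inj (sym φy≡φ0)))))
... | no  _    = fibre-≤1 (φ ∘ suc) (Finₚ.suc-injective ∘ φ-inj) c

fibre-pos⇒∃ : ∀ {n t} (φ : Fin n → Fin t) {c} → 0 < fibre φ c → ∃[ y ] φ y ≡ c
fibre-pos⇒∃ φ {c} pos with Finₚ.any? (λ y → φ y Finₚ.≟ c)
... | yes found = found
... | no  ∄y    = contradiction (sym (fibre-∉ φ (λ y φy≡c → ∄y (y , φy≡c)))) (<⇒≢ pos)

colour-count-bound : ∀ {m n t} (φ : Fin m → Fin n → Fin t) →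
  (∀ i → Injective _≡_ _≡_ (φ i)) →
  (∀ {i j} → i ≢ j → ∀ x y w → φ i x ≡ φ j y → φ i y ≡ φ j w → ⊥) →
  10 * (m * n) ≤ 12 * t + m * (m + 1) * n
colour-count-bound {m} {n} {t} φ φ-injective no-alternation = begin
  10 * (m * n)                              ≡⟨ solve (m ∷ n ∷ []) ⟩
  2 * (5 * (m * n))                         ≡⟨ cong (λ s → 2 * (5 * s)) ∑k≡mn ⟨
  2 * (5 * ∑[ c < t ] k c)                  ≡⟨ cong (2 *_) (*-distribˡ-sum 5 k) ⟩
  2 * ∑[ c < t ] (5 * k c)                  ≤⟨ *-monoʳ-≤ 2 (∑-mono-≤ (λ c → 5k≤6+k² (k c))) ⟩
  2 * ∑[ c < t ] (6 + k c * k c)            ≡⟨ cong (2 *_) (∑-distrib-+ (λ _ → 6) (λ c → k c * k c)) ⟩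
  2 * (∑[ c < t ] 6 + ∑k²)                  ≡⟨ cong (λ s → 2 * (s + ∑k²)) (∑-const t 6) ⟩
  2 * (t * 6 + ∑k²)                         ≡⟨ double t ∑k² ⟩
  12 * t + 2 * ∑k²                          ≤⟨ +-monoʳ-≤ (12 * t) 2∑k²≤ ⟩
  12 * t + m * (m + 1) * n                  ∎
  where
  open ≤-Reasoning

  k : Fin t → ℕ
  k c = ∑[ i < m ] fibre (φ i) c

  ∑k² : ℕ
  ∑k² = ∑[ c < t ] (k c * k c)

  P : Fin m → Fin m → ℕ
  P i j = ∑[ y < n ] fibre (φ j) (φ i y)

  ∑k≡mn : ∑[ c < t ] k c ≡ m * n
  ∑k≡mn = trans (∑-comm (λ c i → fibre (φ i) c))
                (trans (sum-cong-≗ (λ i → ∑-fibre (φ i))) (∑-const m n))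

  ∑k²≡∑∑P : ∑k² ≡ ∑[ i < m ] ∑[ j < m ] P i j
  ∑k²≡∑∑P = trans (∑-square (λ i c → fibre (φ i) c))
                  (sum-cong-≗ (λ i → sum-cong-≗ (λ j → ∑-fibre-* (φ i) (fibre (φ j)))))

  fibre-φ-≤1 : ∀ i c → fibre (φ i) c ≤ 1
  fibre-φ-≤1 i = fibre-≤1 (φ i) (φ-injective i)

  P-diagonal : ∀ i → P i i ≤ n
  P-diagonal i = ∑-≤1 (λ y → fibre-φ-≤1 i (φ i y))

  P-off-diagonal : ∀ {i j} → i ≢ j → P i j + P j i ≤ n
  P-off-diagonal {i} {j} i≢j =
    ≤-trans (≤-reflexive (sym (∑-distrib-+ (λ y → fibre (φ j) (φ i y)) (λ y → fibre (φ i) (φ j y)))))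
            (∑-≤1 (λ y → +-≤1 (fibre-φ-≤1 j (φ i y)) (fibre-φ-≤1 i (φ j y)) (alternation y)))
    where
    alternation : ∀ y → 0 < fibre (φ j) (φ i y) → 0 < fibre (φ i) (φ j y) → ⊥
    alternation y iy-at-j jy-at-i with fibre-pos⇒∃ (φ j) iy-at-j | fibre-pos⇒∃ (φ i) jy-at-i
    ... | w , jw≡iy | x , ix≡jy = no-alternation i≢j x y w ix≡jy (sym jw≡iy)

  2∑k²≤ : 2 * ∑k² ≤ m * (m + 1) * n
  2∑k²≤ = ≤-trans (≤-reflexive (cong (2 *_) ∑k²≡∑∑P))
                  (∑∑-symmetric-bound n P P-diagonal P-off-diagonal)

  double : ∀ t q → 2 * (t * 6 + q) ≡ 12 * t + 2 * q
  double = solve-∀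

adjacent⇒≢ : ∀ G {u v} → Adj G u v → u ≢ v
adjacent⇒≢ G u~v refl = irrefl G u~v

module _ {G : Graph} {t} (S : StarEdgeColoring G t) where
  open StarEdgeColoring S

  colour : ∀ {u v} → Adj G u v → Fin t
  colour {u} {v} = col coloring u v

  colour-flip : ∀ {u v} (p : Adj G u v) → colour (adj-sym G p) ≡ colour p
  colour-flip p = sym (col-sym coloring p)

  equal-colours⇒≢ : ∀ {u v u′ v′} (p : Adj G u v) (q : Adj G u′ v′) →
    v ≢ v′ → colour p ≡ colour q → u ≢ u′
  equal-colours⇒≢ p q v≢v′ same refl = proper p q v≢v′ same

  no-alternating-walk : ∀ {v0 v1 v2 v3 v4}
    (e1 : Adj G v0 v1) (e2 : Adj G v1 v2) (e3 : Adj G v2 v3) (e4 : Adj G v3 v4) →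
    v0 ≢ v3 → v1 ≢ v3 → v1 ≢ v4 → colour e1 ≡ colour e3 → colour e2 ≡ colour e4 → ⊥
  no-alternating-walk {v0} {v1} {v2} {v3} {v4} e1 e2 e3 e4 v0≢v3 v1≢v3 v1≢v4 e1≡e3 e2≡e4 =
    star walk (colour e1 , colour e2 , inj₁ refl , inj₂ refl , inj₁ (sym e1≡e3) , inj₂ (sym e2≡e4))
    where
    e4≡e2 : colour (adj-sym G e4) ≡ colour (adj-sym G e2)
    e4≡e2 = trans (colour-flip e4) (trans (sym e2≡e4) (sym (colour-flip e2)))

    walk : PathOrCycle4 G
    walk = record
      { v0 = v0 ; v1 = v1 ; v2 = v2 ; v3 = v3 ; v4 = v4
      ; e1 = e1 ; e2 = e2 ; e3 = e3 ; e4 = e4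
      ; d01 = adjacent⇒≢ G e1
      ; d02 = equal-colours⇒≢ e1 e3 v1≢v3 e1≡e3
      ; d03 = v0≢v3
      ; d12 = adjacent⇒≢ G e2
      ; d13 = v1≢v3
      ; d14 = v1≢v4
      ; d23 = adjacent⇒≢ G e3
      ; d24 = equal-colours⇒≢ (adj-sym G e2) (adj-sym G e4) v1≢v3 (sym e4≡e2)
      ; d34 = adjacent⇒≢ G e4
      }

module _ {m n : ℕ} where
  left : Fin m → Fin (m + n)
  left i = i ↑ˡ n

  right : Fin n → Fin (m + n)
  right y = m ↑ʳ y

  left~right : ∀ i y → Adj (Kbip m n) (left i) (right y)
  left~right i y = inj₁ ( subst (_< m) (sym (Finₚ.toℕ-↑ˡ i n)) (Finₚ.toℕ<n i)
                        , subst (m ≤_) (sym (Finₚ.toℕ-↑ʳ m y)) (m≤m+n m (toℕ y)))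

  module _ {t} (S : StarEdgeColoring (Kbip m n) t) where
    open StarEdgeColoring S

    edgeColour : Fin m → Fin n → Fin t
    edgeColour i y = colour S (left~right i y)

    edgeColour-injective : ∀ i → Injective _≡_ _≡_ (edgeColour i)
    edgeColour-injective i {x} {y} same with x Finₚ.≟ y
    ... | yes x≡y = x≡y
    ... | no  x≢y = contradiction same (proper (left~right i x) (left~right i y) (x≢y ∘ Finₚ.↑ʳ-injective m x y))

    edgeColour-no-alternation : ∀ {i j} → i ≢ j → ∀ x y w →
      edgeColour i x ≡ edgeColour j y → edgeColour i y ≡ edgeColour j w → ⊥
    edgeColour-no-alternation {i} {j} i≢j x y w ix≡jy iy≡jw =
      no-alternating-walk S (adj-sym G (left~right i x)) (left~right i y)
                            (adj-sym G (left~right j y)) (left~right j w)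
        (adjacent⇒≢ G (adj-sym G (left~right j x)))
        (i≢j ∘ Finₚ.↑ˡ-injective n i j)
        (adjacent⇒≢ G (left~right i w))
        (trans (colour-flip S (left~right i x)) (trans ix≡jy (sym (colour-flip S (left~right j y)))))
        iy≡jw
      where G = Kbip m n

    Kbip-star-bound : 10 * (m * n) ≤ 12 * t + m * (m + 1) * n
    Kbip-star-bound = colour-count-bound edgeColour edgeColour-injective edgeColour-no-alternation

proposition4 : (d : ℕ) → 4 ≤ d → StarIndexAtLeast (Kbip 4 d) (10 * d) 6
proposition4 d _ t S = *-cancelˡ-≤ 2 (+-cancelʳ-≤ (20 * d) (2 * (10 * d)) (2 * (6 * t)) (begin
  2 * (10 * d) + 20 * d      ≡⟨ solve (d ∷ []) ⟩
  10 * (4 * d)               ≤⟨ Kbip-star-bound S ⟩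
  12 * t + 4 * (4 + 1) * d   ≡⟨ solve (t ∷ d ∷ []) ⟩
  2 * (6 * t) + 20 * d       ∎))
  where open ≤-Reasoning
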